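{- Let $G=(V,E)$ be a $d$-regular graph, $x\in V$, and let $\eta_1,\dots,\eta_d:B_1(x)\to V$ be maps satisfying: (i) $\eta_i(u)\sim u$ for all $u\in B_1(x)$ and all $i$; (ii) $\eta_i(u)\ne\eta_j(u)$ for all $u\in B_1(x)$ whenever $i\ne j$; (iii) $\bigcup_j\eta_j(\eta_i x)=\bigcup_j\eta_i(\eta_j x)$ for all $i$. Then each $\eta_i$ is a bijection from $B_1(x)$ onto $B_1(\eta_i x)$.
   Context: $G$ is simple, undirected, connected with finite degree $d$; $B_1(u)=\{v: d(u,v)\le1\}$ for the combinatorial distance $d$. -}

module Defs where

open import Data.Nat using (ℕ)
open import Data.Fin using (Fin)
open import Data.Product using (Σ; ∃; _×_; _,_)
open import Data.Sum using (_⊎_)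
open import Relation.Nullary using (¬_)
open import Relation.Binary.PropositionalEquality using (_≡_)

record Graph : Set₁ where
  field
    V     : Set
    _∼_   : V → V → Set
    ∼-sym : ∀ {u v} → u ∼ v → v ∼ u
    ∼-irr : ∀ {u} → ¬ (u ∼ u)

module _ (G : Graph) where
  open Graph G

  data Walk : V → V → Set where
    here : ∀ {u} → Walk u u
    step : ∀ {u v w} → u ∼ v → Walk v w → Walk u w

  Connected : Set
  Connected = ∀ u v → Walk u v

  Regular : ℕ → Set
  Regular d = ∀ u → Σ (Fin d → V) λ f →
                (∀ k → u ∼ f k)
              × (∀ k l → f k ≡ f l → k ≡ l)
              × (∀ v → u ∼ v → ∃ λ k → f k ≡ v)

  -- B₁(u) = { v : d(u,v) ≤ 1 } = {u} ∪ neighbours of u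
  B₁ : V → V → Set
  B₁ u v = v ≡ u ⊎ u ∼ v

  BijectionOn : (V → V) → V → V → Set
  BijectionOn f x y =
      (∀ u → B₁ x u → B₁ y (f u))
    × (∀ u v → B₁ x u → B₁ x v → f u ≡ f v → u ≡ v)
    × (∀ w → B₁ y w → ∃ λ u → B₁ x u × f u ≡ w)

module Submission where

-- Let y = η_i x.  For every u ∈ B₁(x) the d vertices η_j u are
-- pairwise distinct neighbours of u; since u has exactly d neighbours, they are
-- ALL its neighbours.  Hence the neighbours of x are the η_j x and those of y
-- are the η_k y, and hypothesis (iii) says that the family j ↦ η_i (η_j x)
-- has the same image as the injective family k ↦ η_k y; two d-element
-- families with equal image, one of them injective, make the other injective
-- as well.  So η_i sends x to y and the neighbours of x injectively onto the
-- neighbours of y, none of which is y itself: a bijection B₁(x) → B₁(y).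

open import Defs
open import Data.Nat using (ℕ; suc)
open import Data.Nat.Properties using (1+n≰n)
open import Data.Fin using (Fin; punchOut)
open import Data.Fin.Properties using (any?; _≟_; injective⇒≤; punchOut-injective)
open import Data.Product using (∃; _×_; _,_)
open import Data.Sum using (inj₁; inj₂)
open import Function.Bundles using (_⇔_; Equivalence)
open import Function.Definitions using (Injective)
open import Relation.Nullary using (¬_; yes; no; contradiction)
open import Relation.Nullary.Decidable using (decidable-stable)
open import Relation.Binary.PropositionalEquality using (_≡_; refl; sym; trans; cong; subst)

-- Pigeonhole: an injective self-map of a finite set is surjective.  If g
-- missed the value k, then g with k punched out of its codomain would be an
-- injection Fin (suc n) → Fin n.
injective⇒surjective : ∀ {n} (g : Fin n → Fin n) → Injective _≡_ _≡_ g →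
                       ∀ k → ∃ λ j → g j ≡ k
injective⇒surjective {suc n} g g-inj k with any? (λ j → g j ≟ k)
... | yes hit  = hit
... | no  miss = contradiction (injective⇒≤ {f = g-without-k} g-without-k-inj) 1+n≰n
  where
  k∉g : ∀ j → ¬ k ≡ g j
  k∉g j k≡gj = miss (j , sym k≡gj)

  g-without-k : Fin (suc n) → Fin n
  g-without-k j = punchOut (k∉g j)

  g-without-k-inj : Injective _≡_ _≡_ g-without-k
  g-without-k-inj {j} {l} e = g-inj (punchOut-injective (k∉g j) (k∉g l) e)

distinct⇒injective : ∀ {n} {A : Set} (e : Fin n → A) →
                     (∀ i j → ¬ i ≡ j → ¬ e i ≡ e j) → Injective _≡_ _≡_ e
distinct⇒injective e distinct {i} {j} ei≡ej =
  decidable-stable (i ≟ j) (λ i≢j → distinct i j i≢j ei≡ej)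

-- Reindexing a inside b is an injective self-map σ
-- of Fin n, hence a bijection; consequently b lies inside a and b is
-- injective too.
module SameSizeCover {n} {A : Set} (a b : Fin n → A)
                     (a-inj : Injective _≡_ _≡_ a)
                     (a⊆b : ∀ k → ∃ λ j → a k ≡ b j) where

  σ : Fin n → Fin n
  σ k with j , _ ← a⊆b k = j

  σ-spec : ∀ k → a k ≡ b (σ k)
  σ-spec k with _ , ak≡bj ← a⊆b k = ak≡bj

  σ-inj : Injective _≡_ _≡_ σ
  σ-inj {k} {l} σk≡σl = a-inj (trans (σ-spec k) (trans (cong b σk≡σl) (sym (σ-spec l))))

  b⊆a : ∀ j → ∃ λ k → b j ≡ a k
  b⊆a j with k , refl ← injective⇒surjective σ σ-inj j = k , sym (σ-spec k)

  b-inj : Injective _≡_ _≡_ b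
  b-inj {j} {j′} bj≡bj′
    with k , refl ← injective⇒surjective σ σ-inj j
       | k′ , refl ← injective⇒surjective σ σ-inj j′ =
    cong σ (a-inj (trans (σ-spec k) (trans bj≡bj′ (sym (σ-spec k′)))))

module _ (G : Graph) where
  open Graph G

  -- In a d-regular graph, d pairwise distinct neighbours of u are all the
  -- neighbours of u: the enumeration of the neighbourhood given by
  -- regularity covers them, so by counting they cover it.
  regular-exhausts : ∀ {d} → Regular G d → ∀ u (e : Fin d → V) →
                     (∀ k → u ∼ e k) → Injective _≡_ _≡_ e →
                     ∀ v → u ∼ v → ∃ λ k → v ≡ e k
  regular-exhausts reg u e u∼e e-inj v u∼v
    with f , _ , _ , f-onto ← reg u
    with l , refl ← f-onto v u∼v =
    SameSizeCover.b⊆a e f e-inj e⊆f l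
    where
    e⊆f : ∀ k → ∃ λ j → e k ≡ f j
    e⊆f k with j , fj≡ek ← f-onto (e k) (u∼e k) = j , sym fj≡ek

  module OnBall (d : ℕ) (reg : Regular G d) (x : V) (η : Fin d → V → V)
                (η-adj : ∀ i u → B₁ G x u → η i u ∼ u)
                (η-distinct : ∀ i j u → B₁ G x u → ¬ i ≡ j → ¬ η i u ≡ η j u)
                (η-commute : ∀ i w → (∃ λ j → w ≡ η j (η i x)) ⇔ (∃ λ j → w ≡ η i (η j x)))
                (i : Fin d) where

    y : V
    y = η i x

    x∈B₁x : B₁ G x x
    x∈B₁x = inj₁ refl

    ηx∈B₁x : ∀ j → B₁ G x (η j x)
    ηx∈B₁x j = inj₂ (∼-sym (η-adj j x x∈B₁x))

    y∈B₁x : B₁ G x y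
    y∈B₁x = ηx∈B₁x i

    η-exhausts : ∀ u → B₁ G x u → ∀ v → u ∼ v → ∃ λ j → v ≡ η j u
    η-exhausts u u∈B = regular-exhausts reg u (λ j → η j u)
      (λ j → ∼-sym (η-adj j u u∈B))
      (distinct⇒injective (λ j → η j u) (λ j k → η-distinct j k u u∈B))

    two-step⇒from-y : ∀ j → ∃ λ k → η i (η j x) ≡ η k y
    two-step⇒from-y j = Equivalence.from (η-commute i (η i (η j x))) (j , refl)

    from-y⇒two-step : ∀ k → ∃ λ j → η k y ≡ η i (η j x)
    from-y⇒two-step k = Equivalence.to (η-commute i (η k y)) (k , refl)

    two-step-adj : ∀ j → y ∼ η i (η j x)
    two-step-adj j with k , e ← two-step⇒from-y j =
      subst (y ∼_) (sym e) (∼-sym (η-adj k y y∈B₁x))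

    two-step≢y : ∀ j → ¬ η i (η j x) ≡ y
    two-step≢y j e = ∼-irr (subst (y ∼_) e (two-step-adj j))

    two-step-inj : Injective _≡_ _≡_ (λ j → η i (η j x))
    two-step-inj = SameSizeCover.b-inj (λ k → η k y) (λ j → η i (η j x))
      (distinct⇒injective (λ k → η k y) (λ k l → η-distinct k l y y∈B₁x))
      from-y⇒two-step

    maps-into : ∀ u → B₁ G x u → B₁ G y (η i u)
    maps-into u (inj₁ refl) = inj₁ refl
    maps-into u (inj₂ x∼u) with j , refl ← η-exhausts x x∈B₁x u x∼u =
      inj₂ (two-step-adj j)

    injective-on : ∀ u v → B₁ G x u → B₁ G x v → η i u ≡ η i v → u ≡ v
    injective-on u v (inj₁ refl) (inj₁ refl) _ = refl
    injective-on u v (inj₁ refl) (inj₂ x∼v) e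
      with j , refl ← η-exhausts x x∈B₁x v x∼v = contradiction (sym e) (two-step≢y j)
    injective-on u v (inj₂ x∼u) (inj₁ refl) e
      with j , refl ← η-exhausts x x∈B₁x u x∼u = contradiction e (two-step≢y j)
    injective-on u v (inj₂ x∼u) (inj₂ x∼v) e
      with j , refl ← η-exhausts x x∈B₁x u x∼u
         | j′ , refl ← η-exhausts x x∈B₁x v x∼v = cong (λ t → η t x) (two-step-inj e)

    onto : ∀ w → B₁ G y w → ∃ λ u → B₁ G x u × η i u ≡ w
    onto w (inj₁ refl) = x , x∈B₁x , refl
    onto w (inj₂ y∼w)
      with k , w≡ηky ← η-exhausts y y∈B₁x w y∼w
      with j , w≡two-step ← Equivalence.to (η-commute i w) (k , w≡ηky) =
      η j x , ηx∈B₁x j , sym w≡two-step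

lemma3p2 : (G : Graph) (d : ℕ) → Connected G → Regular G d →
    (x : Graph.V G) (η : Fin d → Graph.V G → Graph.V G) →
    (∀ i u → B₁ G x u → Graph._∼_ G (η i u) u) →
    (∀ i j u → B₁ G x u → ¬ i ≡ j → ¬ η i u ≡ η j u) →
    (∀ i w → (∃ λ j → w ≡ η j (η i x)) ⇔ (∃ λ j → w ≡ η i (η j x))) →
    ∀ i → BijectionOn G (η i) x (η i x)
lemma3p2 G d _ reg x η η-adj η-distinct η-commute i = maps-into , injective-on , onto
  where open OnBall G d reg x η η-adj η-distinct η-commute i
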